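{- (i) Let $\ell<k$, let $\xi_0,\dots,\xi_k,\theta_0,\dots,\theta_\ell\in\mathrm{Inj}(\mathbb{N})$, and for $\tau\in\mathrm{Inj}(\mathbb{N})$ let $\tilde\varphi(\tau)=\xi_k\tau\xi_{k-1}\tau\cdots\tau\xi_0$ and $\tilde\psi(\tau)=\theta_\ell\tau\theta_{\ell-1}\tau\cdots\tau\theta_0$ (if $\ell=0$, $\tilde\psi(\tau)=\theta_0$). Then $\{\tau\in\mathrm{Inj}(\mathbb{N}):\tilde\varphi(\tau)\neq\tilde\psi(\tau)\}$ is dense and open in the topology of pointwise convergence on $\mathrm{Inj}(\mathbb{N})$. (ii) Let $\ell<k$, let $p_0,\dots,p_k,q_0,\dots,q_\ell\in\mathrm{End}(\mathbb{G})$, and for $s\in\mathrm{End}(\mathbb{G})$ let $\varphi(s)=p_ksp_{k-1}s\cdots sp_0$ and $\psi(s)=q_\ell sq_{\ell-1}s\cdots sq_0$ (if $\ell=0$, $\psi(s)=q_0$). Then there exists a dense open subset $V$ of $\mathrm{Inj}(\mathbb{N})$ (in the topology of pointwise convergence) such that $\tau\ltimes t\in M_{\varphi,\psi}=\{s\in\mathrm{End}(\mathbb{G}):\varphi(s)\neq\psi(s)\}$ for all $\tau\in V$ and all $t\in\mathrm{End}(\mathbb{K}_{2,\omega})$. In particular, $\tau\ltimes c_{ -1}\in M_{\varphi,\psi}$ for all $\tau\in V$.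
   Context: $\mathrm{Inj}(\mathbb{N})$ is the monoid of injective maps $\mathbb{N}\to\mathbb{N}$, with the topology of pointwise convergence (subspace of the product topology on $\mathbb{N}^{\mathbb{N}}$, discrete factors). $\mathbb{K}_{2,\omega}$ is the graph on $K_{2,\omega}=A_{+1}\sqcup A_{ -1}$ ($A_{\pm1}$ disjoint countably infinite) with edge relation $A_{ -1}\times A_{+1}\cup A_{+1}\times A_{ -1}$. $\mathbb{G}$ is the structure on $G=\mathbb{N}\times K_{2,\omega}$ with relations $E_1=\{((i,x),(j,y)):i\neq j\}$ and $E_2=\{((i,x),(j,y)):i=j,\ (x,y)\text{ an edge of }\mathbb{K}_{2,\omega}\}$. For $\tau\colon\mathbb{N}\to\mathbb{N}$ and $t\colon K_{2,\omega}\to K_{2,\omega}$, $\tau\ltimes t$ is the map $(i,x)\mapsto(\tau(i),t(x))$ on $G$. Fix $a_{+1}\in A_{+1}$, $a_{ -1}\in A_{ -1}$; $c_{ -1}\in\mathrm{End}(\mathbb{K}_{2,\omega})$ maps every element of $A_e$ to $a_{ -e}$ ($e=\pm1$). -}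

module Defs where

open import Data.Nat using (ℕ; zero; suc; _<_)
open import Data.Fin using (Fin; fromℕ; inject₁)
open import Data.Product using (Σ; ∃; _×_; _,_; proj₁)
open import Data.Sign using (Sign; +; -)
open import Function using (_∘_)
open import Function.Definitions using (Injective)
open import Relation.Binary.PropositionalEquality using (_≡_; _≢_)

-- Words  w_k τ w_{k-1} τ ⋯ τ w_0   (rightmost factor w_0 is applied first)

word : {X : Set} (k : ℕ) → (Fin (suc k) → X → X) → (X → X) → X → X
word zero    w τ = w (fromℕ zero)
word (suc k) w τ = w (fromℕ (suc k)) ∘ τ ∘ word k (w ∘ inject₁) τ

IsInj : (ℕ → ℕ) → Set
IsInj f = Injective _≡_ _≡_ f

Inj : Set
Inj = Σ (ℕ → ℕ) IsInj

-- σ and τ agree on {0,…,n-1}; these sets form a neighbourhood base at τ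
AgreeBelow : ℕ → (ℕ → ℕ) → (ℕ → ℕ) → Set
AgreeBelow n σ τ = ∀ i → i < n → σ i ≡ τ i

IsOpen : (Inj → Set) → Set
IsOpen S = ∀ τ → S τ → ∃ λ (n : ℕ) → ∀ σ → AgreeBelow n (proj₁ σ) (proj₁ τ) → S σ

IsDense : (Inj → Set) → Set
IsDense S = ∀ (τ : Inj) (n : ℕ) → ∃ λ (σ : Inj) → AgreeBelow n (proj₁ σ) (proj₁ τ) × S σ

_≠fun_ : {X Y : Set} → (X → Y) → (X → Y) → Set
_≠fun_ {X} f g = Σ X λ x → f x ≢ g x

-- 𝕂_{2,ω}: A_{+1} = {+} × ℕ,  A_{-1} = {-} × ℕ

K : Set
K = Sign × ℕ

sgn : K → Sign
sgn (s , _) = s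

EdgeK : K → K → Set
EdgeK x y = sgn x ≢ sgn y

IsEndK : (K → K) → Set
IsEndK t = ∀ x y → EdgeK x y → EdgeK (t x) (t y)

-- c_{-1} for fixed a_{+1} = (+ , a₊), a_{-1} = (- , a₋)
cminus : ℕ → ℕ → K → K
cminus a₊ a₋ (+ , _) = (- , a₋)
cminus a₊ a₋ (- , _) = (+ , a₊)

G : Set
G = ℕ × K

E₁ : G → G → Set
E₁ (i , x) (j , y) = i ≢ j

E₂ : G → G → Set
E₂ (i , x) (j , y) = (i ≡ j) × EdgeK x y

IsEndG : (G → G) → Set
IsEndG s = (∀ u v → E₁ u v → E₁ (s u) (s v)) × (∀ u v → E₂ u v → E₂ (s u) (s v))

EndG : Set
EndG = Σ (G → G) IsEndG

_⋉_ : (ℕ → ℕ) → (K → K) → G → G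
(τ ⋉ t) (i , x) = (τ i , t x)

M : (k l : ℕ) → (Fin (suc k) → EndG) → (Fin (suc l) → EndG) → (G → G) → Set
M k l p q s = IsEndG s × (word k (proj₁ ∘ p) s ≠fun word l (proj₁ ∘ q) s)

-- Openness holds because a word evaluated at a point reads its argument at finitely many points.
-- For density, start from τ on [0, n) and odd numbers elsewhere, and follow the trajectories of
-- a suitable x under φ and ψ. Each time a trajectory meets a point where σ is not yet fixed,
-- send it to a fresh even number whose image under the next letter exceeds everything fixed so
-- far; even values keep σ injective. As ψ contains fewer occurrences of τ, the trajectory of φ
-- makes a last such jump beyond the endpoint of ψ.
-- Part (ii) reduces to part (i): an endomorphism of 𝔾 maps each fibre {i} × K into a single
-- fibre, and the induced map on ℕ is injective.
module Submission where

open import Defs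
open import Data.Nat
  using (ℕ; zero; suc; _+_; _*_; _<_; _≤_; _⊔_; s≤s; s≤s⁻¹; _≤′_; ≤′-refl; ≤′-step)
open import Data.Nat using (_≟_; _<?_; _≤?_; parity)
open import Data.Nat.Properties
open import Data.Parity.Base using (1ℙ; 0ℙ) renaming (_+_ to _+ℙ_)
import Data.Parity.Properties as ℙ
open import Data.Fin using (Fin; toℕ; fromℕ; fromℕ<; inject₁; _↑ˡ_; _↑ʳ_; splitAt)
import Data.Fin.Properties as Fin
import Data.Sign as Sign
open import Data.Product using (Σ; ∃; _×_; _,_; proj₁; proj₂)
open import Data.Sum using (_⊎_; inj₁; inj₂; [_,_]′)
import Data.Sum as Sum
open import Data.Empty using (⊥-elim)
open import Function using (_∘_; id)
open import Function.Definitions using (Injective)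
open import Relation.Nullary using (yes; no; contradiction)
open import Relation.Nullary.Decidable using (_×-dec_)
open import Relation.Binary.PropositionalEquality

parity-even : ∀ m → parity (2 * m) ≡ 0ℙ
parity-even m = ℙ.*-homo-* 2 m

parity-odd : ∀ m → parity (1 + 2 * m) ≡ 1ℙ
parity-odd m = trans (ℙ.+-homo-+ 1 (2 * m)) (cong (1ℙ +ℙ_) (parity-even m))

record FreshValue (B : ℕ) (f g : ℕ → ℕ) : Set where
  field
    value : ℕ
    even : parity value ≡ 0ℙ
    value-above : B ≤ value
    f-above : B ≤ f value
    g-above : B ≤ g value

open FreshValue

candidate : ∀ B → Fin (suc (B + B)) → ℕ
candidate B i = 2 * (B + toℕ i)

candidate-injective : ∀ B → Injective _≡_ _≡_ (candidate B)
candidate-injective B eq = Fin.toℕ-injective (+-cancelˡ-≡ B _ _ (*-cancelˡ-≡ _ _ 2 eq))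

↑ˡ≢↑ʳ : ∀ {m n} (i : Fin m) (j : Fin n) → i ↑ˡ n ≢ m ↑ʳ j
↑ˡ≢↑ʳ {m} {n} i j eq =
  contradiction (trans (sym (Fin.splitAt-↑ˡ m i n)) (trans (cong (splitAt m) eq) (Fin.splitAt-↑ʳ m n j)))
    λ ()

-- Among the 2B+1 even candidates 2(B+i), at most B have an f-value below B and at most B a
-- g-value below B; otherwise the small values would inject Fin (2B+1) into Fin B ⊎ Fin B.
freshValue : ∀ {f g} → IsInj f → IsInj g → ∀ B → FreshValue B f g
freshValue {f} {g} f-injective g-injective B
  with Fin.any? (λ i → (B ≤? f (candidate B i)) ×-dec (B ≤? g (candidate B i)))
... | yes (i , B≤f , B≤g) = record
  { value = candidate B i ; even = parity-even (B + toℕ i)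
  ; value-above = ≤-trans (m≤m+n B (toℕ i)) (m≤n*m _ 2)
  ; f-above = B≤f ; g-above = B≤g }
... | no none = ⊥-elim (n≮n (B + B) (Fin.injective⇒≤ code-injective))
  where
  small : ∀ i → f (candidate B i) < B ⊎ g (candidate B i) < B
  small i with B ≤? f (candidate B i)
  ... | yes B≤f = inj₂ (≰⇒> (λ B≤g → none (i , B≤f , B≤g)))
  ... | no B≰f = inj₁ (≰⇒> B≰f)

  code : Fin (suc (B + B)) → Fin (B + B)
  code i = [ (λ p → fromℕ< p ↑ˡ B) , (λ p → B ↑ʳ fromℕ< p) ]′ (small i)

  code-injective : Injective _≡_ _≡_ code
  code-injective {i} {j} eq with small i | small j
  ... | inj₁ p | inj₁ q =
    candidate-injective B (f-injective (Fin.fromℕ<-injective _ _ p q (Fin.↑ˡ-injective B _ _ eq)))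
  ... | inj₂ p | inj₂ q =
    candidate-injective B (g-injective (Fin.fromℕ<-injective _ _ p q (Fin.↑ʳ-injective B _ _ eq)))
  ... | inj₁ p | inj₂ q = contradiction eq (↑ˡ≢↑ʳ _ _)
  ... | inj₂ p | inj₁ q = contradiction (sym eq) (↑ˡ≢↑ʳ _ _)

upperBound : (f : ℕ → ℕ) (n : ℕ) → ∃ λ C → ∀ m → m < n → f m < C
upperBound f zero = 0 , λ m ()
upperBound f (suc n) with upperBound f n
... | C , below = C ⊔ suc (f n) , bound
  where
  bound : ∀ m → m < suc n → f m < C ⊔ suc (f n)
  bound m m<1+n with m≤n⇒m<n∨m≡n (s≤s⁻¹ m<1+n)
  ... | inj₁ m<n = <-≤-trans (below m m<n) (m≤m⊔n C _)
  ... | inj₂ refl = m≤n⊔m C _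

redefine : (ℕ → ℕ) → ℕ → ℕ → ℕ → ℕ
redefine σ a N m with m ≟ a
... | yes _ = N
... | no _ = σ m

redefine-at : ∀ σ a N → redefine σ a N a ≡ N
redefine-at σ a N with a ≟ a
... | yes _ = refl
... | no a≢a = contradiction refl a≢a

redefine-elim : ∀ (P : ℕ → Set) {σ a N} m → P N → P (σ m) → P (redefine σ a N m)
redefine-elim P {a = a} m pN pσ with m ≟ a
... | yes _ = pN
... | no _ = pσ

redefine-agrees : ∀ σ {a N D} → D ≤ a → AgreeBelow D (redefine σ a N) σ
redefine-agrees σ {a} D≤a m m<D with m ≟ a
... | yes refl = contradiction D≤a (<⇒≱ m<D)
... | no _ = refl

redefine-injective : ∀ {σ a N} → IsInj σ → (∀ m → N ≢ σ m) → IsInj (redefine σ a N)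
redefine-injective {a = a} σ-injective new {m} {m′} eq with m ≟ a | m′ ≟ a
... | yes m≡a | yes m′≡a = trans m≡a (sym m′≡a)
... | yes _ | no _ = contradiction eq (new m′)
... | no _ | yes _ = contradiction (sym eq) (new m)
... | no _ | no _ = σ-injective eq

OddAbove : ℕ → (ℕ → ℕ) → Set
OddAbove R σ = ∀ m → σ m < R ⊎ parity (σ m) ≡ 1ℙ

even∉OddAbove : ∀ {R σ N} → OddAbove R σ → R ≤ N → parity N ≡ 0ℙ → ∀ m → N ≢ σ m
even∉OddAbove odd R≤N even m refl with odd m
... | inj₁ σm<R = <⇒≱ σm<R R≤N
... | inj₂ σm-odd = contradiction (trans (sym even) σm-odd) λ ()

redefine-oddAbove : ∀ {R σ N} → OddAbove R σ → R ≤ N → ∀ a → OddAbove (suc N) (redefine σ a N)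
redefine-oddAbove {R} {N = N} odd R≤N a m =
  redefine-elim (λ v → v < suc N ⊎ parity v ≡ 1ℙ) m
    (inj₁ ≤-refl) (Sum.map₁ (λ σm<R → <-≤-trans σm<R (m≤n⇒m≤1+n R≤N)) (odd m))

wordN : ℕ → (ℕ → ℕ → ℕ) → (ℕ → ℕ) → ℕ → ℕ
wordN zero F σ = F 0
wordN (suc j) F σ = F (suc j) ∘ σ ∘ wordN j F σ

extend : ∀ {A : Set} k → (Fin (suc k) → A) → A → ℕ → A
extend k w d j with j <? suc k
... | yes j<1+k = w (fromℕ< j<1+k)
... | no _ = d

extend-toℕ : ∀ {A : Set} k (w : Fin (suc k) → A) d i → extend k w d (toℕ i) ≡ w i
extend-toℕ k w d i with toℕ i <? suc k
... | yes i<1+k = cong w (Fin.fromℕ<-toℕ i i<1+k)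
... | no i≮1+k = contradiction (Fin.toℕ<n i) i≮1+k

extend-all : ∀ {A : Set} (P : A → Set) k (w : Fin (suc k) → A) d →
             (∀ i → P (w i)) → P d → ∀ j → P (extend k w d j)
extend-all P k w d Pw Pd j with j <? suc k
... | yes j<1+k = Pw (fromℕ< j<1+k)
... | no _ = Pd

word≗wordN : ∀ k (w : Fin (suc k) → ℕ → ℕ) (F : ℕ → ℕ → ℕ) →
             (∀ i → F (toℕ i) ≡ w i) → ∀ σ x → word k w σ x ≡ wordN k F σ x
word≗wordN zero w F F≡w σ x = sym (cong-app (F≡w (fromℕ 0)) x)
word≗wordN (suc k) w F F≡w σ x =
  cong₂ (λ h y → h (σ y)) (sym last) (word≗wordN k (w ∘ inject₁) F earlier σ x)
  where
  last : F (suc k) ≡ w (fromℕ (suc k))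
  last = trans (cong F (sym (Fin.toℕ-fromℕ (suc k)))) (F≡w (fromℕ (suc k)))
  earlier : ∀ i → F (toℕ i) ≡ w (inject₁ i)
  earlier i = trans (cong F (sym (Fin.toℕ-inject₁ i))) (F≡w (inject₁ i))

agreeBelow-mono : ∀ {m n σ τ} → m ≤ n → AgreeBelow n σ τ → AgreeBelow m σ τ
agreeBelow-mono m≤n σ≈τ i i<m = σ≈τ i (<-≤-trans i<m m≤n)

record Settled (F : ℕ → ℕ → ℕ) (j x D : ℕ) (σ : ℕ → ℕ) (a : ℕ) : Set where
  constructor settled
  field
    at : ∀ σ′ → AgreeBelow D σ′ σ → wordN j F σ′ x ≡ a

settled-value : ∀ {F j x D σ a} → Settled F j x D σ a → wordN j F σ x ≡ a
settled-value (settled at) = at _ (λ _ _ → refl)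

settled-mono : ∀ {F j x D D′ σ σ′ a} → Settled F j x D σ a →
               D ≤ D′ → AgreeBelow D σ′ σ → Settled F j x D′ σ′ a
settled-mono (settled at) D≤D′ σ′≈σ = settled λ σ″ σ″≈σ′ →
  at σ″ (λ m m<D → trans (σ″≈σ′ m (<-≤-trans m<D D≤D′)) (σ′≈σ m m<D))

settled-step : ∀ {F j x D D′ σ σ′ a} → Settled F j x D σ a →
               D ≤ D′ → AgreeBelow D σ′ σ → a < D′ →
               Settled F (suc j) x D′ σ′ (F (suc j) (σ′ a))
settled-step {F} {j} {x} {σ′ = σ′} {a} a-settled D≤D′ σ′≈σ a<D′ =
  settled λ σ″ σ″≈σ′ → cong (F (suc j)) (begin
    σ″ (wordN j F σ″ x)  ≡⟨ cong σ″ (Settled.at (settled-mono a-settled D≤D′ σ′≈σ) _ σ″≈σ′) ⟩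
    σ″ a                 ≡⟨ σ″≈σ′ a a<D′ ⟩
    σ′ a                 ∎)
  where open ≡-Reasoning

word-modulus : ∀ k → (Fin (suc k) → ℕ → ℕ) → (ℕ → ℕ) → ℕ → ℕ
word-modulus zero w τ x = 0
word-modulus (suc k) w τ x = word-modulus k (w ∘ inject₁) τ x ⊔ suc (word k (w ∘ inject₁) τ x)

word-local : ∀ k w {σ τ} x → AgreeBelow (word-modulus k w τ x) σ τ → word k w σ x ≡ word k w τ x
word-local zero w x σ≈τ = refl
word-local (suc k) w {σ} {τ} x σ≈τ = cong (w (fromℕ (suc k))) (begin
  σ (word k w′ σ x)  ≡⟨ cong σ (word-local k w′ x (agreeBelow-mono (m≤m⊔n _ _) σ≈τ)) ⟩
  σ (word k w′ τ x)  ≡⟨ σ≈τ _ (m≤n⊔m _ _) ⟩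
  τ (word k w′ τ x)  ∎)
  where
  open ≡-Reasoning
  w′ : Fin (suc k) → ℕ → ℕ
  w′ = w ∘ inject₁

Separating : ∀ k l → (Fin (suc k) → ℕ → ℕ) → (Fin (suc l) → ℕ → ℕ) → Inj → Set
Separating k l w v τ = word k w (proj₁ τ) ≠fun word l v (proj₁ τ)

separating-isOpen : ∀ k l w v → IsOpen (Separating k l w v)
separating-isOpen k l w v (τ , _) (x , differ) =
  word-modulus k w τ x ⊔ word-modulus l v τ x , λ (σ , _) σ≈τ → x , λ eq → differ (begin
    word k w τ x  ≡⟨ sym (word-local k w x (agreeBelow-mono (m≤m⊔n _ _) σ≈τ)) ⟩
    word k w σ x  ≡⟨ eq ⟩
    word l v σ x  ≡⟨ word-local l v x (agreeBelow-mono (m≤n⊔m _ _) σ≈τ) ⟩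
    word l v τ x  ∎)
  where open ≡-Reasoning

module Density (τ : ℕ → ℕ) (τ-injective : IsInj τ) (n : ℕ)
               (F Θ : ℕ → ℕ → ℕ)
               (F-injective : ∀ j → IsInj (F j)) (Θ-injective : ∀ j → IsInj (Θ j)) where

  record Approx : Set where
    field
      σ : ℕ → ℕ
      R : ℕ
      injective : IsInj σ
      oddAbove : OddAbove R σ
      agrees : AgreeBelow n σ τ

  assign : (s : Approx) (a : ℕ) → n ≤ a → ∀ {B f g} → FreshValue (Approx.R s ⊔ B) f g → Approx
  assign s a n≤a {B} v = record
    { σ = redefine σ a (value v)
    ; R = suc (value v)
    ; injective = redefine-injective injective (even∉OddAbove oddAbove R≤v (even v))
    ; oddAbove = redefine-oddAbove oddAbove R≤v a
    ; agrees = λ m m<n → trans (redefine-agrees σ n≤a m m<n) (agrees m m<n)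
    }
    where
    open Approx s
    R≤v : R ≤ value v
    R≤v = m⊔n≤o⇒m≤o R B (value-above v)

  C : ℕ
  C = proj₁ (upperBound τ n)

  τ<C : ∀ m → m < n → τ m < C
  τ<C = proj₂ (upperBound τ n)

  C≤odd : ∀ m → C ≤ 1 + 2 * (C + m)
  C≤odd m = ≤-trans (m≤m+n C m) (≤-trans (m≤n*m _ 2) (n≤1+n _))

  initialMap : ℕ → ℕ
  initialMap m with m <? n
  ... | yes _ = τ m
  ... | no _ = 1 + 2 * (C + m)

  initialMap-injective : IsInj initialMap
  initialMap-injective {m} {m′} eq with m <? n | m′ <? n
  ... | yes _ | yes _ = τ-injective eq
  ... | yes m<n | no _ = contradiction eq (<⇒≢ (<-≤-trans (τ<C m m<n) (C≤odd m′)))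
  ... | no _ | yes m′<n = contradiction (sym eq) (<⇒≢ (<-≤-trans (τ<C m′ m′<n) (C≤odd m)))
  ... | no _ | no _ = +-cancelˡ-≡ C _ _ (*-cancelˡ-≡ _ _ 2 (suc-injective eq))

  initialMap-oddAbove : OddAbove C initialMap
  initialMap-oddAbove m with m <? n
  ... | yes m<n = inj₁ (τ<C m m<n)
  ... | no _ = inj₂ (parity-odd (C + m))

  initialMap-agrees : AgreeBelow n initialMap τ
  initialMap-agrees m m<n with m <? n
  ... | yes _ = refl
  ... | no m≮n = contradiction m<n m≮n

  start : FreshValue n (F 0) (Θ 0)
  start = freshValue (F-injective 0) (Θ-injective 0) n

  x : ℕ
  x = value start

  record Stage (j m : ℕ) : Set where
    field
      approx : Approx
      D a b : ℕ
      n≤D : n ≤ D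
      D≤a : D ≤ a
      a-settled : Settled F j x D (Approx.σ approx) a
      b-settled : Settled Θ m x D (Approx.σ approx) b

  initial : Stage 0 0
  initial = record
    { approx = record { σ = initialMap ; R = C ; injective = initialMap-injective
                      ; oddAbove = initialMap-oddAbove ; agrees = initialMap-agrees }
    ; D = n ; a = F 0 x ; b = Θ 0 x ; n≤D = ≤-refl ; D≤a = f-above start
    ; a-settled = settled λ _ _ → refl ; b-settled = settled λ _ _ → refl }

  -- If a = b, the second assignment overwrites the first; both values are fresh for both letters.
  advanceBoth : ∀ {j} (st : Stage j j) → Stage.D st ≤ Stage.b st →
                Σ (Stage (suc j) (suc j)) λ st′ → Stage.D st′ ≤ Stage.b st′
  advanceBoth {j} st D≤b = record
      { approx = s₂ ; D = D′ ; a = F (suc j) (σ₂ a) ; b = Θ (suc j) (σ₂ b)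
      ; n≤D = ≤-trans n≤D D≤D′ ; D≤a = D′≤F[σ₂a]
      ; a-settled = settled-step a-settled D≤D′ σ₂≈σ a<D′
      ; b-settled = settled-step b-settled D≤D′ σ₂≈σ b<D′ }
    , D′≤Θ[σ₂b]
    where
    open Stage st
    open Approx approx
    D′ : ℕ
    D′ = suc (D ⊔ a ⊔ b)
    D≤D′ : D ≤ D′
    D≤D′ = m≤n⇒m≤1+n (≤-trans (m≤m⊔n D a) (m≤m⊔n _ b))
    a<D′ : a < D′
    a<D′ = s≤s (≤-trans (m≤n⊔m D a) (m≤m⊔n _ b))
    b<D′ : b < D′
    b<D′ = s≤s (m≤n⊔m _ b)
    v₁ : FreshValue (R ⊔ D′) (F (suc j)) (Θ (suc j))
    v₁ = freshValue (F-injective _) (Θ-injective _) _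
    s₁ : Approx
    s₁ = assign approx a (≤-trans n≤D D≤a) {D′} v₁
    v₂ : FreshValue (suc (value v₁) ⊔ D′) (F (suc j)) (Θ (suc j))
    v₂ = freshValue (F-injective _) (Θ-injective _) _
    s₂ : Approx
    s₂ = assign s₁ b (≤-trans n≤D D≤b) {D′} v₂
    σ₂ : ℕ → ℕ
    σ₂ = Approx.σ s₂
    σ₂≈σ : AgreeBelow D σ₂ σ
    σ₂≈σ m m<D = trans (redefine-agrees _ D≤b m m<D) (redefine-agrees σ D≤a m m<D)
    D′≤F[σ₂a] : D′ ≤ F (suc j) (σ₂ a)
    D′≤F[σ₂a] = redefine-elim (λ N → D′ ≤ F (suc j) N) a
      (m⊔n≤o⇒n≤o (suc (value v₁)) D′ (f-above v₂))
      (subst (λ N → D′ ≤ F (suc j) N) (sym (redefine-at σ a _)) (m⊔n≤o⇒n≤o R D′ (f-above v₁)))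
    D′≤Θ[σ₂b] : D′ ≤ Θ (suc j) (σ₂ b)
    D′≤Θ[σ₂b] = subst (λ N → D′ ≤ Θ (suc j) N) (sym (redefine-at (Approx.σ s₁) b _))
      (m⊔n≤o⇒n≤o (suc (value v₁)) D′ (g-above v₂))

  advanceFirst : ∀ {j m} (st : Stage j m) → Σ (Stage (suc j) m) λ st′ → Stage.b st′ < Stage.a st′
  advanceFirst {j} st = record
      { approx = s₁ ; D = D′ ; a = F (suc j) (σ₁ a) ; b = b
      ; n≤D = ≤-trans n≤D D≤D′ ; D≤a = m⊔n≤o⇒m≤o D′ (suc b) F[σ₁a]-large
      ; a-settled = settled-step a-settled D≤D′ σ₁≈σ a<D′
      ; b-settled = settled-mono b-settled D≤D′ σ₁≈σ }
    , m⊔n≤o⇒n≤o D′ (suc b) F[σ₁a]-large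
    where
    open Stage st
    open Approx approx
    D′ : ℕ
    D′ = suc (D ⊔ a)
    D≤D′ : D ≤ D′
    D≤D′ = m≤n⇒m≤1+n (m≤m⊔n D a)
    a<D′ : a < D′
    a<D′ = s≤s (m≤n⊔m D a)
    v : FreshValue (R ⊔ (D′ ⊔ suc b)) (F (suc j)) (F (suc j))
    v = freshValue (F-injective _) (F-injective _) _
    s₁ : Approx
    s₁ = assign approx a (≤-trans n≤D D≤a) {D′ ⊔ suc b} v
    σ₁ : ℕ → ℕ
    σ₁ = Approx.σ s₁
    σ₁≈σ : AgreeBelow D σ₁ σ
    σ₁≈σ = redefine-agrees σ D≤a
    F[σ₁a]-large : D′ ⊔ suc b ≤ F (suc j) (σ₁ a)
    F[σ₁a]-large = subst (λ N → D′ ⊔ suc b ≤ F (suc j) N) (sym (redefine-at σ a _))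
      (m⊔n≤o⇒n≤o R (D′ ⊔ suc b) (f-above v))

  jointly : ∀ j → Σ (Stage j j) λ st → Stage.D st ≤ Stage.b st
  jointly zero = initial , g-above start
  jointly (suc j) with st , D≤b ← jointly j = advanceBoth st D≤b

  firstAhead : ∀ {k l} → suc l ≤′ k → Σ (Stage k l) λ st → Stage.b st < Stage.a st
  firstAhead {l = l} ≤′-refl = advanceFirst (proj₁ (jointly l))
  firstAhead (≤′-step l<k) = advanceFirst (proj₁ (firstAhead l<k))

  stage-separates : ∀ {k l} (st : Stage k l) → Stage.b st < Stage.a st →
                    let σ = Approx.σ (Stage.approx st) in wordN k F σ x ≢ wordN l Θ σ x
  stage-separates st b<a eq =
    <⇒≢ b<a (trans (sym (settled-value b-settled)) (trans (sym eq) (settled-value a-settled)))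
    where open Stage st

  separating : ∀ {k l} → l < k →
               Σ (ℕ → ℕ) λ σ → IsInj σ × AgreeBelow n σ τ ×
                 ∃ λ x → wordN k F σ x ≢ wordN l Θ σ x
  separating l<k with st , b<a ← firstAhead (≤⇒≤′ l<k) =
    σ , injective , agrees , x , stage-separates st b<a
    where open Approx (Stage.approx st)

separating-isDense : ∀ {k l} → l < k → (w : Fin (suc k) → ℕ → ℕ) (v : Fin (suc l) → ℕ → ℕ) →
                     (∀ i → IsInj (w i)) → (∀ i → IsInj (v i)) → IsDense (Separating k l w v)
separating-isDense {k} {l} l<k w v w-injective v-injective (τ , τ-injective) n
  with σ , σ-injective , σ≈τ , x , differ ←
         Density.separating τ τ-injective n (extend k w id) (extend l v id)
           (extend-all IsInj k w id w-injective id) (extend-all IsInj l v id v-injective id) l<k =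
  (σ , σ-injective) , σ≈τ , x , λ eq → differ (trans
    (sym (word≗wordN k w _ (extend-toℕ k w id) σ x))
    (trans eq (word≗wordN l v _ (extend-toℕ l v id) σ x)))

block : EndG → ℕ → ℕ
block (s , _) i = proj₁ (s (i , (Sign.+ , 0)))

-- Every vertex of 𝕂_{2,ω} is adjacent to (+, 0) or to (−, 0), and E₂ forces adjacent vertices
-- of one fibre into one fibre.
block-const : ∀ (p : EndG) i y → proj₁ (proj₁ p (i , y)) ≡ block p i
block-const (s , _ , e₂) i (Sign.- , m) =
  sym (proj₁ (e₂ (i , (Sign.+ , 0)) (i , (Sign.- , m)) (refl , λ ())))
block-const p@(s , _ , e₂) i (Sign.+ , m) =
  trans (proj₁ (e₂ (i , (Sign.+ , m)) (i , (Sign.- , 0)) (refl , λ ()))) (block-const p i (Sign.- , 0))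

block-injective : ∀ p → IsInj (block p)
block-injective (s , e₁ , _) {i} {j} eq with i ≟ j
... | yes i≡j = i≡j
... | no i≢j = contradiction eq (e₁ _ _ i≢j)

word-⋉-block : ∀ k (p : Fin (suc k) → EndG) τ t i y →
               proj₁ (word k (proj₁ ∘ p) (τ ⋉ t) (i , y)) ≡ word k (block ∘ p) τ i
word-⋉-block zero p τ t i y = block-const (p (fromℕ 0)) i y
word-⋉-block (suc k) p τ t i y =
  trans (block-const (p (fromℕ (suc k))) _ _)
        (cong (block (p (fromℕ (suc k))) ∘ τ) (word-⋉-block k (p ∘ inject₁) τ t i y))

⋉-isEndG : ∀ {τ t} → IsInj τ → IsEndK t → IsEndG (τ ⋉ t)
⋉-isEndG {τ} τ-injective t-isEndK =
  (λ u v i≢j eq → i≢j (τ-injective eq)) , λ u v (i≡j , edge) → cong τ i≡j , t-isEndK _ _ edge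

cminus-isEndK : ∀ a₊ a₋ → IsEndK (cminus a₊ a₋)
cminus-isEndK a₊ a₋ (Sign.+ , _) (Sign.+ , _) edge = contradiction refl edge
cminus-isEndK a₊ a₋ (Sign.+ , _) (Sign.- , _) edge = λ ()
cminus-isEndK a₊ a₋ (Sign.- , _) (Sign.+ , _) edge = λ ()
cminus-isEndK a₊ a₋ (Sign.- , _) (Sign.- , _) edge = contradiction refl edge

separating-⋉ : ∀ {k l} (p : Fin (suc k) → EndG) (q : Fin (suc l) → EndG) τ →
               Separating k l (block ∘ p) (block ∘ q) τ → ∀ t → IsEndK t → M k l p q (proj₁ τ ⋉ t)
separating-⋉ {k} {l} p q (τ , τ-injective) (i , differ) t t-isEndK =
  ⋉-isEndG {τ} {t} τ-injective t-isEndK , (i , (Sign.+ , 0)) , λ eq →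
    differ (trans (sym (word-⋉-block k p τ t i _)) (trans (cong proj₁ eq) (word-⋉-block l q τ t i _)))

lemma4p13 : (∀ (k l : ℕ) → l < k → (ξ : Fin (suc k) → Inj) → (θ : Fin (suc l) → Inj) →
    let S = λ (τ : Inj) → word k (proj₁ ∘ ξ) (proj₁ τ) ≠fun word l (proj₁ ∘ θ) (proj₁ τ)
    in IsDense S × IsOpen S)
    ×
    (∀ (k l : ℕ) → l < k → (p : Fin (suc k) → EndG) → (q : Fin (suc l) → EndG) →
    ∃ λ (V : Inj → Set) → IsDense V × IsOpen V
    × (∀ τ → V τ → ∀ t → IsEndK t → M k l p q (proj₁ τ ⋉ t))
    × (∀ (a₊ a₋ : ℕ) → ∀ τ → V τ → M k l p q (proj₁ τ ⋉ cminus a₊ a₋)))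
lemma4p13 =
  (λ k l l<k ξ θ →
    separating-isDense l<k _ _ (proj₂ ∘ ξ) (proj₂ ∘ θ) , separating-isOpen k l _ _) ,
  λ k l l<k p q →
    Separating k l (block ∘ p) (block ∘ q) ,
    separating-isDense l<k _ _ (block-injective ∘ p) (block-injective ∘ q) ,
    separating-isOpen k l _ _ ,
    separating-⋉ p q ,
    λ a₊ a₋ τ separated → separating-⋉ p q τ separated _ (cminus-isEndK a₊ a₋)
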